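{- Let $G$ be a cluster graph and $k,\eta$ non-negative integers. If there exists $F\subseteq\binom{V(G)}{2}\setminus E(G)$ with $|F|\le k$ such that $G+F$ is an $\eta$-balanced cluster graph, then either $G$ is $\eta$-balanced, or there exist an integer $\ell\in[2k]\setminus\{1\}$, a partition $X=\{x_1,\dots,x_t\}$ of $\ell$, and partitions $X_1,\dots,X_t$ with $X_i$ a partition of $x_i$ for each $i\in[t]$, such that: (1) the multiset $X'=\bigcup_{i\in[t]}X_i$ is $G$-valid; (2) $\sum_{i\in[t]}\mathrm{spp}(X_i)\le k$; and (3) some completion of $G$ with respect to $(X,\{X_1,\dots,X_t\})$ is $\eta$-balanced.
   Context: A cluster graph is a graph in which every connected component is a clique; for a non-negative integer $\eta$, a graph is $\eta$-balanced if any two connected components differ in number of vertices by at most $\eta$. $G+F$ denotes $(V(G),E(G)\cup F)$. A partition of a positive integer is a multiset of positive integers summing to it; the union of multisets is additive (multiplicities add). For a partition $Y=\{y_1,\dots,y_q\}$, $\mathrm{spp}(Y)=0$ if $q=1$ and otherwise $\mathrm{spp}(Y)=\sum_{1\le i<j\le q}y_iy_j$ (sum of products over unordered pairs of elements). A partition $\{z_1,\dots,z_r\}$ is $G$-valid if $G$ has $r$ distinct components $C_1,\dots,C_r$ with $|V(C_i)|=z_i$. Given $X=\{x_1,\dots,x_t\}$ and partitions $X_i=\{x_{i1},\dots,x_{ir_i}\}$ of $x_i$ with $\bigcup_iX_i$ $G$-valid, a completion of $G$ with respect to $(X,\{X_1,\dots,X_t\})$ is obtained by choosing pairwise distinct components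 $G_{ij}$ ($i\in[t]$, $j\in[r_i]$) of $G$ with $|V(G_{ij})|=x_{ij}$ and, for each $i\in[t]$, adding all edges needed to make $\bigcup_{j\in[r_i]}V(G_{ij})$ a clique. -}

module Defs where

open import Data.Nat using (ℕ; zero; suc; _+_; _*_; _≤_; _<_)
open import Data.Fin using (Fin; toℕ)
open import Data.List using (List; []; _∷_; length; concat)
open import Data.Nat.ListAction using (sum)
open import Data.List.Membership.Propositional using (_∈_)
open import Data.List.Relation.Unary.All using (All)
open import Data.List.Relation.Unary.AllPairs using (AllPairs)
open import Data.List.Relation.Unary.Unique.Propositional using (Unique)
open import Data.List.Relation.Binary.Pointwise using (Pointwise)
open import Data.Product using (Σ; _×_; ∃₂)
open import Data.Sum using (_⊎_)
open import Relation.Binary.PropositionalEquality using (_≡_; _≢_)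
open import Relation.Binary.Construct.Closure.ReflexiveTransitive using (Star)
open import Relation.Nullary using (¬_)

Graph : ℕ → Set₁
Graph n = Fin n → Fin n → Set

IsSimple : ∀ {n} → Graph n → Set
IsSimple {n} G = (∀ (u v : Fin n) → G u v → G v u) × (∀ (u : Fin n) → ¬ G u u)

Reach : ∀ {n} → Graph n → Fin n → Fin n → Set
Reach G = Star G

IsCluster : ∀ {n} → Graph n → Set
IsCluster {n} G = IsSimple G × (∀ (u v : Fin n) → u ≢ v → Reach G u v → G u v)

CompSize : ∀ {n} → Graph n → Fin n → ℕ → Set
CompSize {n} G v s =
  Σ (List (Fin n)) λ xs → Unique xs × (∀ w → (w ∈ xs → Reach G v w) × (Reach G v w → w ∈ xs))
    × length xs ≡ s

Balanced : ∀ {n} → Graph n → ℕ → Set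
Balanced {n} G η = ∀ (u v : Fin n) (s t : ℕ) → CompSize G u s → CompSize G v t → s ≤ t + η

-- F ⊆ (V(G) choose 2) \ E(G), unordered pairs stored as (u , v) with u < v, no repetitions
IsNonEdgeSet : ∀ {n} → Graph n → List (Fin n × Fin n) → Set
IsNonEdgeSet G F = Unique F × All (λ p → (toℕ (Data.Product.proj₁ p) < toℕ (Data.Product.proj₂ p))
                                       × ¬ G (Data.Product.proj₁ p) (Data.Product.proj₂ p)) F

_+E_ : ∀ {n} → Graph n → List (Fin n × Fin n) → Graph n
(G +E F) u v = G u v ⊎ ((u Data.Product., v) ∈ F ⊎ (v Data.Product., u) ∈ F)

IsPartition : ℕ → List ℕ → Set
IsPartition m Y = All (λ y → 1 ≤ y) Y × sum Y ≡ m

spp : List ℕ → ℕ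
spp [] = 0
spp (y ∷ ys) = y * sum ys + spp ys

-- Z (a multiset) is G-valid, witnessed by representatives reps of pairwise
-- distinct components with |component of reps_i| = z_i
ValidWitness : ∀ {n} → Graph n → List ℕ → List (Fin n) → Set
ValidWitness G Z reps = Pointwise (λ z r → CompSize G r z) Z reps × AllPairs (λ a b → ¬ Reach G a b) reps

IsGValid : ∀ {n} → Graph n → List ℕ → Set
IsGValid {n} G Z = Σ (List (Fin n)) λ reps → ValidWitness G Z reps

-- completion of G: reps groups the chosen components G_ij (by a representative
-- vertex) into t groups; each group's union of vertices is made a clique
Completion : ∀ {n} → Graph n → List (List (Fin n)) → Graph n
Completion {n} G reps u w =
  G u w ⊎ (u ≢ w × Σ (List (Fin n)) λ rs → rs ∈ reps ×
                    ∃₂ λ a b → a ∈ rs × b ∈ rs × Reach G a u × Reach G b w)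

IsCompletionChoice : ∀ {n} → Graph n → List (List ℕ) → List (List (Fin n)) → Set
IsCompletionChoice G Xs reps =
  Pointwise (λ Xi rs → Pointwise (λ x r → CompSize G r x) Xi rs) Xs reps
  × AllPairs (λ a b → ¬ Reach G a b) (concat reps)

{-# OPTIONS --safe #-}
module Submission where

-- If F is empty, G = G + F is balanced.  Otherwise every component of G + F containing an edge
-- of F is the union of r ≥ 2 components of G, of sizes X_i = {x_i1, …, x_ir}; being a clique, all
-- spp(X_i) pairs of its vertices in different G-components are edges of F, so Σ spp(X_i) ≤ |F| ≤ k.
-- As every part has a partner, ℓ = Σ x_ij ≤ 2 Σ spp(X_i) ≤ 2k.  Completing G on exactly these
-- groups of components rebuilds the components of G + F, hence is η-balanced.
-- A component is represented by its least vertex; as the adjacency of G need not be decidable,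
-- the components of vertices incident to F are computed from F alone.

open import Defs
open import Level using (Level)
open import Function using (_∘_)
open import Data.Empty using (⊥-elim)
open import Data.Nat using (ℕ; suc; _+_; _*_; _≤_; _<_; z≤n; s≤s)
open import Data.Nat.Properties
  using ( ≤-trans; <-irrefl; m≤m+n; m≤n+m; m≤n⇒m≤1+n; +-mono-≤; *-monoʳ-≤; *-monoˡ-≤
        ; *-identityʳ; *-identityˡ; +-identityʳ; +-suc; *-distribˡ-+; *-cancelˡ-≤; module ≤-Reasoning)
open import Data.Nat.ListAction using (sum)
open import Data.Nat.Solver using (module +-*-Solver)
open import Data.Fin using (Fin; toℕ; inject; fromℕ<)
import Data.Fin as Fin
import Data.Fin.Properties as Finₚ
open import Data.Product using (Σ; _×_; _,_; proj₁; proj₂; ∃-syntax; swap)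
open import Data.Product.Properties using (≡-dec)
open import Data.Sum using (_⊎_; inj₁; inj₂)
open import Data.List
  using (List; []; _∷_; _++_; length; map; concat; concatMap; filter; allFin; cartesianProduct)
open import Data.List.Properties using (length-++; length-map)
open import Data.List.Membership.Propositional using (_∈_; find)
open import Data.List.Membership.Propositional.Properties
  using ( ∈-∃++; ∈-++⁻; ∈-++⁺ˡ; ∈-++⁺ʳ; ∈-filter⁺; ∈-filter⁻; ∈-allFin; ∈-map⁺; ∈-map⁻
        ; ∈-concatMap⁻; ∈-cartesianProduct⁻)
import Data.List.Membership.DecPropositional as DecMembership
open import Data.List.Relation.Binary.Subset.Propositional using (_⊆_)
open import Data.List.Relation.Binary.Disjoint.Propositional using (Disjoint)
open import Data.List.Relation.Binary.Pointwise as Pointwise using (Pointwise; []; _∷_)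
open import Data.List.Relation.Unary.Any using (here; there)
open import Data.List.Relation.Unary.All as All using (All; []; _∷_)
import Data.List.Relation.Unary.All.Properties as Allₚ
open import Data.List.Relation.Unary.AllPairs as AllPairs using (AllPairs; []; _∷_)
import Data.List.Relation.Unary.AllPairs.Properties as AllPairsₚ
open import Data.List.Relation.Unary.Unique.Propositional using (Unique)
import Data.List.Relation.Unary.Unique.Propositional.Properties as Uniqueₚ
open import Relation.Nullary using (¬_; yes; no; ¬?)
open import Relation.Nullary.Decidable using (decidable-stable; _×-dec_; _⊎-dec_; _→-dec_)
open import Relation.Unary using (Pred; Decidable)
open import Relation.Binary using (Rel; IsEquivalence; Symmetric; _⇒_)
import Relation.Binary as B
open import Relation.Binary.Definitions using (tri<; tri≈; tri>)
open import Relation.Binary.PropositionalEquality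
  using (_≡_; _≢_; refl; sym; trans; cong; cong₂; subst; module ≡-Reasoning)
open import Relation.Binary.Construct.Closure.ReflexiveTransitive as Star
  using (Star; ε; _◅_; _◅◅_)

private
  variable
    a b ℓ : Level
    A : Set a
    B : Set b

least : ∀ {n} {P : Pred (Fin n) ℓ} → Decidable P → ∀ {i} → P i →
        ∃[ j ] P j × (∀ k → k Fin.< j → ¬ P k)
least {n = n} {P = P} P? {i} Pi
  with Finₚ.¬∀⟶∃¬-smallest n (¬_ ∘ P) (¬? ∘ P?) (λ ∀¬P → ∀¬P i Pi)
... | j , ¬¬Pj , below =
  j , decidable-stable (P? j) ¬¬Pj , λ k k<j → below (fromℕ< k<j) ∘ subst P (sym (inject-fromℕ< k<j))
  where
  inject-fromℕ< : ∀ {k} (k<j : toℕ k < toℕ j) → inject {i = j} (fromℕ< k<j) ≡ k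
  inject-fromℕ< k<j =
    Finₚ.toℕ-injective (trans (Finₚ.toℕ-inject (fromℕ< k<j)) (Finₚ.toℕ-fromℕ< k<j))

Unique-⊆⇒length≤ : {xs ys : List A} → Unique xs → xs ⊆ ys → length xs ≤ length ys
Unique-⊆⇒length≤ {xs = []} _ _ = z≤n
Unique-⊆⇒length≤ {xs = x ∷ xs} (x∉xs ∷ xs!) xs⊆ys with ∈-∃++ (xs⊆ys (here refl))
... | ys₁ , ys₂ , refl = begin
  suc (length xs)               ≤⟨ s≤s (Unique-⊆⇒length≤ xs! xs⊆ys₁++ys₂) ⟩
  suc (length (ys₁ ++ ys₂))     ≡⟨ cong suc (length-++ ys₁) ⟩
  suc (length ys₁ + length ys₂) ≡⟨ sym (+-suc (length ys₁) (length ys₂)) ⟩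
  length ys₁ + suc (length ys₂) ≡⟨ sym (length-++ ys₁) ⟩
  length (ys₁ ++ x ∷ ys₂)       ∎
  where
  open ≤-Reasoning
  xs⊆ys₁++ys₂ : xs ⊆ ys₁ ++ ys₂
  xs⊆ys₁++ys₂ y∈xs with ∈-++⁻ ys₁ (xs⊆ys (there y∈xs))
  ... | inj₁ y∈ys₁         = ∈-++⁺ˡ y∈ys₁
  ... | inj₂ (here refl)   = ⊥-elim (All.lookup x∉xs y∈xs refl)
  ... | inj₂ (there y∈ys₂) = ∈-++⁺ʳ ys₁ y∈ys₂

Unique⇒AllPairs : ∀ {R : A → A → Set ℓ} {xs} → Unique xs →
                  (∀ {x y} → x ∈ xs → y ∈ xs → x ≢ y → R x y) → AllPairs R xs
Unique⇒AllPairs [] R-distinct = []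
Unique⇒AllPairs (x∉xs ∷ xs!) R-distinct =
  All.tabulate (λ y∈xs → R-distinct (here refl) (there y∈xs) (All.lookup x∉xs y∈xs))
  ∷ Unique⇒AllPairs xs! (λ x∈ y∈ → R-distinct (there x∈) (there y∈))

∈-≢⇒2≤length : ∀ {x y : A} {xs} → x ∈ xs → y ∈ xs → x ≢ y → 2 ≤ length xs
∈-≢⇒2≤length (here refl) (here refl) x≢y = ⊥-elim (x≢y refl)
∈-≢⇒2≤length {xs = _ ∷ _ ∷ _} (here _) (there _) _ = s≤s (s≤s z≤n)
∈-≢⇒2≤length {xs = _ ∷ _ ∷ _} (there _) (here _) _ = s≤s (s≤s z≤n)
∈-≢⇒2≤length (there x∈) (there y∈) x≢y = m≤n⇒m≤1+n (∈-≢⇒2≤length x∈ y∈ x≢y)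

length-cartesianProduct : (xs : List A) (ys : List B) →
                          length (cartesianProduct xs ys) ≡ length xs * length ys
length-cartesianProduct [] ys = refl
length-cartesianProduct (x ∷ xs) ys = begin
  length (map (x ,_) ys ++ cartesianProduct xs ys)         ≡⟨ length-++ (map (x ,_) ys) ⟩
  length (map (x ,_) ys) + length (cartesianProduct xs ys) ≡⟨ cong₂ _+_ (length-map (x ,_) ys)
                                                                       (length-cartesianProduct xs ys) ⟩
  length ys + length xs * length ys                        ∎
  where open ≡-Reasoning

length-concatMap : (f : A → List B) (xs : List A) → length (concatMap f xs) ≡ sum (map (length ∘ f) xs)
length-concatMap f [] = refl
length-concatMap f (x ∷ xs) = trans (length-++ (f x)) (cong (length (f x) +_) (length-concatMap f xs))

All⇒Pointwise-map : ∀ {R : B → A → Set ℓ} {f : A → B} {xs} →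
                    All (λ x → R (f x) x) xs → Pointwise R (map f xs) xs
All⇒Pointwise-map [] = []
All⇒Pointwise-map (Rfx ∷ Rfxs) = Rfx ∷ All⇒Pointwise-map Rfxs

∈⇒≤sum : ∀ {x xs} → x ∈ xs → x ≤ sum xs
∈⇒≤sum {xs = x ∷ xs} (here refl) = m≤m+n x (sum xs)
∈⇒≤sum {xs = y ∷ xs} (there x∈) = ≤-trans (∈⇒≤sum x∈) (m≤n+m (sum xs) y)

length≤sum : ∀ {ys} → All (1 ≤_) ys → length ys ≤ sum ys
length≤sum [] = z≤n
length≤sum (1≤y ∷ 1≤ys) = +-mono-≤ 1≤y (length≤sum 1≤ys)

sum≤2*spp : ∀ {ys} → All (1 ≤_) ys → 2 ≤ length ys → sum ys ≤ 2 * spp ys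
sum≤2*spp {y ∷ []} _ (s≤s ())
sum≤2*spp {y ∷ z ∷ zs} (1≤y ∷ 1≤z ∷ _) _ = begin
  y + s                 ≤⟨ +-mono-≤ y≤y*s s≤y*s ⟩
  y * s + y * s         ≡⟨ cong (y * s +_) (sym (+-identityʳ (y * s))) ⟩
  2 * (y * s)           ≤⟨ *-monoʳ-≤ 2 (m≤m+n (y * s) (spp (z ∷ zs))) ⟩
  2 * spp (y ∷ z ∷ zs)  ∎
  where
  open ≤-Reasoning
  s = z + sum zs
  y≤y*s : y ≤ y * s
  y≤y*s = subst (_≤ y * s) (*-identityʳ y) (*-monoʳ-≤ y (≤-trans 1≤z (m≤m+n z (sum zs))))
  s≤y*s : s ≤ y * s
  s≤y*s = subst (_≤ y * s) (*-identityˡ s) (*-monoˡ-≤ s 1≤y)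

sum-map-sum≤2*sum-map-spp : ∀ {Ys} → All (λ Y → All (1 ≤_) Y × 2 ≤ length Y) Ys →
                            sum (map sum Ys) ≤ 2 * sum (map spp Ys)
sum-map-sum≤2*sum-map-spp [] = z≤n
sum-map-sum≤2*sum-map-spp {Y ∷ Ys} ((pos , 2≤len) ∷ proper) = begin
  sum Y + sum (map sum Ys)         ≤⟨ +-mono-≤ (sum≤2*spp pos 2≤len) (sum-map-sum≤2*sum-map-spp proper) ⟩
  2 * spp Y + 2 * sum (map spp Ys) ≡⟨ sym (*-distribˡ-+ 2 (spp Y) (sum (map spp Ys))) ⟩
  2 * sum (map spp (Y ∷ Ys))       ∎
  where open ≤-Reasoning

Reach-isEquivalence : ∀ {n} {G : Graph n} → IsSimple G → IsEquivalence (Reach G)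
Reach-isEquivalence (G-sym , _) = record
  { refl = ε ; sym = Star.reverse (G-sym _ _) ; trans = _◅◅_ }

Balanced-resp-Reach : ∀ {n} {G H : Graph n} {η} → Reach G ⇒ Reach H → Reach H ⇒ Reach G →
                      Balanced G η → Balanced H η
Balanced-resp-Reach {G = G} {H} G⇒H H⇒G balanced u v s t u-size v-size =
  balanced u v s t (CompSize-resp u-size) (CompSize-resp v-size)
  where
  CompSize-resp : ∀ {v s} → CompSize H v s → CompSize G v s
  CompSize-resp (ws , ws! , ∈ws⇔reach , |ws|≡s) =
    ws , ws! , (λ w → H⇒G ∘ proj₁ (∈ws⇔reach w) , proj₂ (∈ws⇔reach w) ∘ G⇒H) , |ws|≡s

HasBalancedCompletion : ∀ {n} → Graph n → ℕ → ℕ → Set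
HasBalancedCompletion {n} G k η =
  Σ ℕ λ ℓ → 2 ≤ ℓ × ℓ ≤ 2 * k × Σ (List ℕ) λ X → IsPartition ℓ X
    × Σ (List (List ℕ)) λ Xs → Pointwise IsPartition X Xs
    × IsGValid G (concat Xs)
    × sum (map spp Xs) ≤ k
    × Σ (List (List (Fin n))) λ reps → IsCompletionChoice G Xs reps
        × Balanced (Completion G reps) η

-- _∼_ need not be decidable; _≈_ is what the search for least representatives decides.
module Leaders {n p q r} {_∼_ : Rel (Fin n) p} (∼-isEquivalence : IsEquivalence _∼_)
  {Active : Pred (Fin n) q} (active? : Decidable Active)
  (Active-resp-∼ : ∀ {i j} → Active i → i ∼ j → Active j)
  {_≈_ : Rel (Fin n) r} (_≈?_ : B.Decidable _≈_)
  (≈⇒∼ : _≈_ ⇒ _∼_) (∼⇒≈ : ∀ {i j} → Active i → i ∼ j → i ≈ j) where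

  open IsEquivalence ∼-isEquivalence renaming (refl to ∼-refl; sym to ∼-sym; trans to ∼-trans)

  IsLeader : Pred (Fin n) _
  IsLeader i = Active i × (∀ j → j Fin.< i → ¬ i ≈ j)

  isLeader? : Decidable IsLeader
  isLeader? i = active? i ×-dec Finₚ.all? (λ j → j Finₚ.<? i →-dec ¬? (i ≈? j))

  leader-unique : ∀ {i j} → IsLeader i → IsLeader j → i ∼ j → i ≡ j
  leader-unique {i} {j} (Ai , i-least) (Aj , j-least) i∼j with Finₚ.<-cmp i j
  ... | tri< i<j _ _ = ⊥-elim (j-least i i<j (∼⇒≈ Aj (∼-sym i∼j)))
  ... | tri≈ _ i≡j _ = i≡j
  ... | tri> _ _ j<i = ⊥-elim (i-least j j<i (∼⇒≈ Ai i∼j))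

  leader-of : ∀ {i} → Active i → ∃[ j ] IsLeader j × j ∼ i
  leader-of {i} Ai with least (i ≈?_) (∼⇒≈ Ai ∼-refl)
  ... | j , i≈j , j-least = j , (Aj , j-leader) , ∼-sym (≈⇒∼ i≈j)
    where
    Aj : Active j
    Aj = Active-resp-∼ Ai (≈⇒∼ i≈j)
    j-leader : ∀ k → k Fin.< j → ¬ j ≈ k
    j-leader k k<j j≈k = j-least k k<j (∼⇒≈ Ai (∼-trans (≈⇒∼ i≈j) (≈⇒∼ j≈k)))

  leaders : List (Fin n)
  leaders = filter isLeader? (allFin n)

  ∈-leaders⁺ : ∀ {i} → IsLeader i → i ∈ leaders
  ∈-leaders⁺ {i} = ∈-filter⁺ isLeader? (∈-allFin i)

  ∈-leaders⁻ : ∀ {i} → i ∈ leaders → IsLeader i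
  ∈-leaders⁻ = proj₂ ∘ ∈-filter⁻ isLeader? {xs = allFin n}

  leaders-apart : AllPairs (λ i j → ¬ i ∼ j) leaders
  leaders-apart = Unique⇒AllPairs (Uniqueₚ.filter⁺ isLeader? (Uniqueₚ.allFin⁺ n))
    (λ i∈ j∈ i≢j i∼j → i≢j (leader-unique (∈-leaders⁻ i∈) (∈-leaders⁻ j∈) i∼j))

module ClusterAugmentation {n} (G : Graph n) (F : List (Fin n × Fin n)) (G-cluster : IsCluster G)
  (F-nonEdges : IsNonEdgeSet G F) (GF-cluster : IsCluster (G +E F)) where

  open DecMembership (≡-dec (Finₚ._≟_ {n}) (Finₚ._≟_ {n})) using (_∈?_)

  private
    GF : Graph n
    GF = G +E F

    G-sym : ∀ {u v} → G u v → G v u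
    G-sym = proj₁ (proj₁ G-cluster) _ _

    ReachG⇒G : ∀ {u v} → u ≢ v → Reach G u v → G u v
    ReachG⇒G = proj₂ G-cluster _ _

    ReachGF⇒GF : ∀ {u v} → u ≢ v → Reach GF u v → GF u v
    ReachGF⇒GF = proj₂ GF-cluster _ _

    module ReachG = IsEquivalence (Reach-isEquivalence (proj₁ G-cluster))
    module ReachGF = IsEquivalence (Reach-isEquivalence (proj₁ GF-cluster))

  _~F_ : Rel (Fin n) _
  u ~F v = (u , v) ∈ F ⊎ (v , u) ∈ F

  _~F?_ : B.Decidable _~F_
  u ~F? v = ((u , v) ∈? F) ⊎-dec ((v , u) ∈? F)

  ~F-sym : Symmetric _~F_
  ~F-sym (inj₁ uv∈F) = inj₂ uv∈F
  ~F-sym (inj₂ vu∈F) = inj₁ vu∈F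

  ~F⇒¬G : ∀ {u v} → u ~F v → ¬ G u v
  ~F⇒¬G (inj₁ uv∈F) = proj₂ (All.lookup (proj₂ F-nonEdges) uv∈F)
  ~F⇒¬G (inj₂ vu∈F) = proj₂ (All.lookup (proj₂ F-nonEdges) vu∈F) ∘ G-sym

  ~F⇒≢ : ∀ {u v} → u ~F v → u ≢ v
  ~F⇒≢ (inj₁ uv∈F) refl = <-irrefl refl (proj₁ (All.lookup (proj₂ F-nonEdges) uv∈F))
  ~F⇒≢ (inj₂ vu∈F) refl = <-irrefl refl (proj₁ (All.lookup (proj₂ F-nonEdges) vu∈F))

  ~F⇒¬ReachG : ∀ {u v} → u ~F v → ¬ Reach G u v
  ~F⇒¬ReachG u~v = ~F⇒¬G u~v ∘ ReachG⇒G (~F⇒≢ u~v)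

  ReachG⇒ReachGF : Reach G ⇒ Reach GF
  ReachG⇒ReachGF = Star.map inj₁

  ~F⇒ReachGF : _~F_ ⇒ Reach GF
  ~F⇒ReachGF u~v = inj₂ u~v ◅ ε

  Merged : Pred (Fin n) _
  Merged r = ∃[ x ] r ~F x

  merged? : Decidable Merged
  merged? r = Finₚ.any? (r ~F?_)

  -- If r ~F x then, G + F being a cluster graph, the G-component of r consists of r and the
  -- F-neighbours of x that are not F-neighbours of r.
  SameG : Rel (Fin n) _
  SameG r w = r ≡ w ⊎ ∃[ x ] r ~F x × x ~F w × ¬ r ~F w

  sameG? : B.Decidable SameG
  sameG? r w = (r Finₚ.≟ w) ⊎-dec Finₚ.any? (λ x → r ~F? x ×-dec x ~F? w ×-dec ¬? (r ~F? w))

  SameG⇒ReachG : SameG ⇒ Reach G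
  SameG⇒ReachG (inj₁ refl) = ε
  SameG⇒ReachG {r} {w} (inj₂ (x , r~x , x~w , r≁w)) with r Finₚ.≟ w
  ... | yes refl = ε
  ... | no r≢w with ReachGF⇒GF r≢w (inj₂ r~x ◅ inj₂ x~w ◅ ε)
  ...   | inj₁ rw∈G = rw∈G ◅ ε
  ...   | inj₂ r~w  = ⊥-elim (r≁w r~w)

  ReachG⇒SameG : ∀ {r w} → Merged r → Reach G r w → SameG r w
  ReachG⇒SameG {r} {w} (x , r~x) r⇝w with r Finₚ.≟ w
  ... | yes r≡w = inj₁ r≡w
  ... | no r≢w with x Finₚ.≟ w
  ...   | yes refl = ⊥-elim (~F⇒¬ReachG r~x r⇝w)
  ...   | no x≢w with ReachGF⇒GF x≢w (inj₂ (~F-sym r~x) ◅ inj₁ (ReachG⇒G r≢w r⇝w) ◅ ε)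
  ...     | inj₁ xw∈G = ⊥-elim (~F⇒¬ReachG r~x (r⇝w ◅◅ G-sym xw∈G ◅ ε))
  ...     | inj₂ x~w  = inj₂ (x , r~x , x~w , λ r~w → ~F⇒¬ReachG r~w r⇝w)

  SameGF : Rel (Fin n) _
  SameGF r w = SameG r w ⊎ r ~F w

  sameGF? : B.Decidable SameGF
  sameGF? r w = sameG? r w ⊎-dec r ~F? w

  SameGF⇒ReachGF : SameGF ⇒ Reach GF
  SameGF⇒ReachGF (inj₁ r≈w) = ReachG⇒ReachGF (SameG⇒ReachG r≈w)
  SameGF⇒ReachGF (inj₂ r~w) = ~F⇒ReachGF r~w

  ReachGF⇒SameGF : ∀ {r w} → Merged r → Reach GF r w → SameGF r w
  ReachGF⇒SameGF {r} {w} r-merged r⇝w with r Finₚ.≟ w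
  ... | yes r≡w = inj₁ (inj₁ r≡w)
  ... | no r≢w with ReachGF⇒GF r≢w r⇝w
  ...   | inj₁ rw∈G = inj₁ (ReachG⇒SameG r-merged (rw∈G ◅ ε))
  ...   | inj₂ r~w  = inj₂ r~w

  Merged-resp-ReachG : ∀ {r w} → Merged r → Reach G r w → Merged w
  Merged-resp-ReachG r-merged r⇝w with ReachG⇒SameG r-merged r⇝w
  ... | inj₁ refl              = r-merged
  ... | inj₂ (x , _ , x~w , _) = x , ~F-sym x~w

  Merged-resp-ReachGF : ∀ {r w} → Merged r → Reach GF r w → Merged w
  Merged-resp-ReachGF {r} r-merged r⇝w with ReachGF⇒SameGF r-merged r⇝w
  ... | inj₁ r≈w = Merged-resp-ReachG r-merged (SameG⇒ReachG r≈w)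
  ... | inj₂ r~w = r , ~F-sym r~w

  module GLeaders = Leaders (Reach-isEquivalence (proj₁ G-cluster)) merged? Merged-resp-ReachG
                            sameG? SameG⇒ReachG ReachG⇒SameG
  module GFLeaders = Leaders (Reach-isEquivalence (proj₁ GF-cluster)) merged? Merged-resp-ReachGF
                             sameGF? SameGF⇒ReachGF ReachGF⇒SameGF

  component : Fin n → List (Fin n)
  component r = filter (sameG? r) (allFin n)

  size : Fin n → ℕ
  size r = length (component r)

  component-unique : ∀ r → Unique (component r)
  component-unique r = Uniqueₚ.filter⁺ (sameG? r) (Uniqueₚ.allFin⁺ n)

  ∈-component⁻ : ∀ {r w} → w ∈ component r → Reach G r w
  ∈-component⁻ {r} = SameG⇒ReachG ∘ proj₂ ∘ ∈-filter⁻ (sameG? r) {xs = allFin n}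

  ∈-component⁺ : ∀ {r w} → Merged r → Reach G r w → w ∈ component r
  ∈-component⁺ {r} {w} r-merged r⇝w =
    ∈-filter⁺ (sameG? r) (∈-allFin w) (ReachG⇒SameG r-merged r⇝w)

  ∈-component-self : ∀ r → r ∈ component r
  ∈-component-self r = ∈-filter⁺ (sameG? r) (∈-allFin r) (inj₁ refl)

  compSize-component : ∀ {r} → Merged r → CompSize G r (size r)
  compSize-component {r} r-merged =
    component r , component-unique r , (λ w → ∈-component⁻ , ∈-component⁺ r-merged) , refl

  1≤size : ∀ r → 1 ≤ size r
  1≤size r with component r | ∈-component-self r
  ... | _ ∷ _ | _ = s≤s z≤n

  block : Fin n → List (Fin n)
  block m = filter (sameGF? m) GLeaders.leaders

  blocks : List (List (Fin n))
  blocks = map block GFLeaders.leaders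

  sizes : List (List ℕ)
  sizes = map (map size) blocks

  ∈-block⁻ : ∀ {m a} → a ∈ block m → GLeaders.IsLeader a × Reach GF m a
  ∈-block⁻ {m} a∈ with ∈-filter⁻ (sameGF? m) {xs = GLeaders.leaders} a∈
  ... | a∈leaders , m≈a = GLeaders.∈-leaders⁻ a∈leaders , SameGF⇒ReachGF m≈a

  ∈-block⁺ : ∀ {m a} → Merged m → GLeaders.IsLeader a → Reach GF m a → a ∈ block m
  ∈-block⁺ {m} m-merged a-leader m⇝a =
    ∈-filter⁺ (sameGF? m) (GLeaders.∈-leaders⁺ a-leader) (ReachGF⇒SameGF m-merged m⇝a)

  ∈-blocks⁻ : ∀ {rs} → rs ∈ blocks → ∃[ m ] GFLeaders.IsLeader m × rs ≡ block m
  ∈-blocks⁻ rs∈ with ∈-map⁻ block rs∈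
  ... | m , m∈ , rs≡ = m , GFLeaders.∈-leaders⁻ m∈ , rs≡

  block-apart : ∀ m → AllPairs (λ a b → ¬ Reach G a b) (block m)
  block-apart m = AllPairsₚ.filter⁺ (sameGF? m) GLeaders.leaders-apart

  blocks-apart : AllPairs (λ a b → ¬ Reach G a b) (concat blocks)
  blocks-apart = AllPairsₚ.concat⁺ (Allₚ.map⁺ (All.tabulate (λ {m} _ → block-apart m)))
    (AllPairsₚ.map⁺ (AllPairs.map distinct-blocks-apart GFLeaders.leaders-apart))
    where
    distinct-blocks-apart : ∀ {m m′} → ¬ Reach GF m m′ →
                            All (λ a → All (λ b → ¬ Reach G a b) (block m′)) (block m)
    distinct-blocks-apart m≁m′ = All.tabulate λ a∈ → All.tabulate λ b∈ a⇝b →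
      m≁m′ (proj₂ (∈-block⁻ a∈) ◅◅ ReachG⇒ReachGF a⇝b ◅◅ ReachGF.sym (proj₂ (∈-block⁻ b∈)))

  2≤length-block : ∀ {m} → GFLeaders.IsLeader m → 2 ≤ length (block m)
  2≤length-block {m} ((x , m~x) , _)
    with GLeaders.leader-of (x , m~x) | GLeaders.leader-of (m , ~F-sym m~x)
  ... | a , a-leader , a⇝m | b , b-leader , b⇝x =
    ∈-≢⇒2≤length
      (∈-block⁺ (x , m~x) a-leader (ReachGF.sym (ReachG⇒ReachGF a⇝m)))
      (∈-block⁺ (x , m~x) b-leader (~F⇒ReachGF m~x ◅◅ ReachGF.sym (ReachG⇒ReachGF b⇝x)))
      (λ { refl → ~F⇒¬ReachG m~x (ReachG.sym a⇝m ◅◅ b⇝x) })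

  sizes-proper : All (λ Y → All (1 ≤_) Y × 2 ≤ length Y) sizes
  sizes-proper = Allₚ.map⁺ (Allₚ.map⁺ (All.tabulate λ {m} m∈ →
    Allₚ.map⁺ (All.tabulate λ {r} _ → 1≤size r) ,
    subst (2 ≤_) (sym (length-map size (block m))) (2≤length-block (GFLeaders.∈-leaders⁻ m∈))))

  completionChoice : IsCompletionChoice G sizes blocks
  completionChoice =
    All⇒Pointwise-map (All.tabulate λ rs∈ → All⇒Pointwise-map (All.tabulate (compSize-block rs∈))) ,
    blocks-apart
    where
    compSize-block : ∀ {rs r} → rs ∈ blocks → r ∈ rs → CompSize G r (size r)
    compSize-block rs∈ r∈ with ∈-blocks⁻ rs∈
    ... | m , _ , refl = compSize-component (proj₁ (proj₁ (∈-block⁻ r∈)))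

  members : List (Fin n) → List (Fin n)
  members = concatMap component

  ∈-members⁻ : ∀ {rs w} → w ∈ members rs → ∃[ r ] r ∈ rs × Reach G r w
  ∈-members⁻ w∈ with find (∈-concatMap⁻ component w∈)
  ... | r , r∈ , w∈component = r , r∈ , ∈-component⁻ w∈component

  ∈-members-block⇒ReachGF : ∀ {m w} → w ∈ members (block m) → Reach GF m w
  ∈-members-block⇒ReachGF w∈ with ∈-members⁻ w∈
  ... | r , r∈ , r⇝w = proj₂ (∈-block⁻ r∈) ◅◅ ReachG⇒ReachGF r⇝w

  component-apart-members : ∀ {r rs} → All (λ r′ → ¬ Reach G r r′) rs →
                            ∀ {a b} → a ∈ component r → b ∈ members rs → ¬ Reach G a b
  component-apart-members r≁rs a∈ b∈ a⇝b with ∈-members⁻ b∈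
  ... | r′ , r′∈ , r′⇝b = All.lookup r≁rs r′∈ (∈-component⁻ a∈ ◅◅ a⇝b ◅◅ ReachG.sym r′⇝b)

  component-disjoint-members : ∀ {r rs} → All (λ r′ → ¬ Reach G r r′) rs →
                               Disjoint (component r) (members rs)
  component-disjoint-members r≁rs (w∈ , w∈′) = component-apart-members r≁rs w∈ w∈′ ε

  members-unique : ∀ {rs} → AllPairs (λ a b → ¬ Reach G a b) rs → Unique (members rs)
  members-unique [] = []
  members-unique {r ∷ _} (r≁rs ∷ apart) =
    Uniqueₚ.++⁺ (component-unique r) (members-unique apart) (component-disjoint-members r≁rs)

  -- Inside a block each of these pairs is an edge of F in one of its two orientations; counting
  -- ordered pairs against F ++ map swap F avoids choosing one.
  crossPairs : List (Fin n) → List (Fin n × Fin n)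
  crossPairs [] = []
  crossPairs (r ∷ rs) = cartesianProduct (component r) (members rs)
                     ++ cartesianProduct (members rs) (component r)
                     ++ crossPairs rs

  length-crossPairs : ∀ rs → length (crossPairs rs) ≡ 2 * spp (map size rs)
  length-crossPairs [] = refl
  length-crossPairs (r ∷ rs) = begin
    length (P₁ ++ P₂ ++ crossPairs rs)               ≡⟨ length-++ P₁ ⟩
    length P₁ + length (P₂ ++ crossPairs rs)         ≡⟨ cong (length P₁ +_) (length-++ P₂) ⟩
    length P₁ + (length P₂ + length (crossPairs rs)) ≡⟨ cong₂ (λ x y → x + (y + length (crossPairs rs)))
                                                          (length-cartesianProduct (component r) (members rs))
                                                          (length-cartesianProduct (members rs) (component r)) ⟩
    c * m + (m * c + length (crossPairs rs))         ≡⟨ cong₂ (λ x y → c * x + (x * c + y))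
                                                          (length-concatMap component rs)
                                                          (length-crossPairs rs) ⟩
    c * s + (s * c + 2 * p)                          ≡⟨ solve 3 (λ c s p → c :* s :+ (s :* c :+ con 2 :* p)
                                                                       := con 2 :* (c :* s :+ p))
                                                          refl c s p ⟩
    2 * (c * s + p)                                  ∎
    where
    open ≡-Reasoning
    open +-*-Solver
    P₁ = cartesianProduct (component r) (members rs)
    P₂ = cartesianProduct (members rs) (component r)
    c = size r
    m = length (members rs)
    s = sum (map size rs)
    p = spp (map size rs)

  ∈-crossPairs⁻ : ∀ {rs a b} → AllPairs (λ a b → ¬ Reach G a b) rs → (a , b) ∈ crossPairs rs →
                  a ∈ members rs × b ∈ members rs × ¬ Reach G a b
  ∈-crossPairs⁻ {r ∷ rs} (r≁rs ∷ apart) ab∈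
    with ∈-++⁻ (cartesianProduct (component r) (members rs)) ab∈
  ... | inj₁ ab∈P₁ with ∈-cartesianProduct⁻ (component r) (members rs) ab∈P₁
  ...   | a∈ , b∈ = ∈-++⁺ˡ a∈ , ∈-++⁺ʳ (component r) b∈ , component-apart-members r≁rs a∈ b∈
  ∈-crossPairs⁻ {r ∷ rs} (r≁rs ∷ apart) ab∈ | inj₂ ab∈P₂P₃
    with ∈-++⁻ (cartesianProduct (members rs) (component r)) ab∈P₂P₃
  ... | inj₁ ab∈P₂ with ∈-cartesianProduct⁻ (members rs) (component r) ab∈P₂
  ...   | a∈ , b∈ = ∈-++⁺ʳ (component r) a∈ , ∈-++⁺ˡ b∈ ,
                    component-apart-members r≁rs b∈ a∈ ∘ ReachG.sym
  ∈-crossPairs⁻ {r ∷ rs} (r≁rs ∷ apart) ab∈ | inj₂ ab∈P₂P₃ | inj₂ ab∈P₃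
    with ∈-crossPairs⁻ apart ab∈P₃
  ... | a∈ , b∈ , a≁b = ∈-++⁺ʳ (component r) a∈ , ∈-++⁺ʳ (component r) b∈ , a≁b

  crossPairs-unique : ∀ {rs} → AllPairs (λ a b → ¬ Reach G a b) rs → Unique (crossPairs rs)
  crossPairs-unique [] = []
  crossPairs-unique {r ∷ rs} (r≁rs ∷ apart) =
    Uniqueₚ.++⁺ (Uniqueₚ.cartesianProduct⁺ (component-unique r) (members-unique apart))
      (Uniqueₚ.++⁺ (Uniqueₚ.cartesianProduct⁺ (members-unique apart) (component-unique r))
                   (crossPairs-unique apart) P₂#P₃)
      P₁#P₂P₃
    where
    P₁ = cartesianProduct (component r) (members rs)
    P₂ = cartesianProduct (members rs) (component r)
    r#rs = component-disjoint-members r≁rs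
    P₂#P₃ : Disjoint P₂ (crossPairs rs)
    P₂#P₃ {a , b} (ab∈P₂ , ab∈P₃) =
      r#rs (proj₂ (∈-cartesianProduct⁻ (members rs) (component r) ab∈P₂) ,
            proj₁ (proj₂ (∈-crossPairs⁻ apart ab∈P₃)))
    P₁#P₂P₃ : Disjoint P₁ (P₂ ++ crossPairs rs)
    P₁#P₂P₃ {a , b} (ab∈P₁ , ab∈P₂P₃)
      with proj₁ (∈-cartesianProduct⁻ (component r) (members rs) ab∈P₁) | ∈-++⁻ P₂ ab∈P₂P₃
    ... | a∈ | inj₁ ab∈P₂ = r#rs (a∈ , proj₁ (∈-cartesianProduct⁻ (members rs) (component r) ab∈P₂))
    ... | a∈ | inj₂ ab∈P₃ = r#rs (a∈ , proj₁ (∈-crossPairs⁻ apart ab∈P₃))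

  crossPairs-block⊆F± : ∀ m → crossPairs (block m) ⊆ F ++ map swap F
  crossPairs-block⊆F± m {a , b} ab∈ with ∈-crossPairs⁻ (block-apart m) ab∈
  ... | a∈ , b∈ , a≁b
    with ReachGF⇒GF (λ { refl → a≁b ε })
                    (ReachGF.sym (∈-members-block⇒ReachGF a∈) ◅◅ ∈-members-block⇒ReachGF b∈)
  ...   | inj₁ ab∈G        = ⊥-elim (a≁b (ab∈G ◅ ε))
  ...   | inj₂ (inj₁ ab∈F) = ∈-++⁺ˡ ab∈F
  ...   | inj₂ (inj₂ ba∈F) = ∈-++⁺ʳ F (∈-map⁺ swap ba∈F)

  allCrossPairs : List (Fin n × Fin n)
  allCrossPairs = concatMap (crossPairs ∘ block) GFLeaders.leaders

  length-allCrossPairs : ∀ ms → length (concatMap (crossPairs ∘ block) ms)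
                                ≡ 2 * sum (map spp (map (map size) (map block ms)))
  length-allCrossPairs [] = refl
  length-allCrossPairs (m ∷ ms) = begin
    length (crossPairs (block m) ++ concatMap (crossPairs ∘ block) ms)
      ≡⟨ length-++ (crossPairs (block m)) ⟩
    length (crossPairs (block m)) + length (concatMap (crossPairs ∘ block) ms)
      ≡⟨ cong₂ _+_ (length-crossPairs (block m)) (length-allCrossPairs ms) ⟩
    2 * spp (map size (block m)) + 2 * sum (map spp (map (map size) (map block ms)))
      ≡⟨ sym (*-distribˡ-+ 2 (spp (map size (block m))) (sum (map spp (map (map size) (map block ms))))) ⟩
    2 * sum (map spp (map (map size) (map block (m ∷ ms))))
      ∎
    where open ≡-Reasoning

  allCrossPairs-unique : Unique allCrossPairs
  allCrossPairs-unique =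
    Uniqueₚ.concat⁺ (Allₚ.map⁺ (All.tabulate λ {m} _ → crossPairs-unique (block-apart m)))
      (AllPairsₚ.map⁺ (AllPairs.map distinct-crossPairs-disjoint GFLeaders.leaders-apart))
    where
    distinct-crossPairs-disjoint : ∀ {m m′} → ¬ Reach GF m m′ →
                                   Disjoint (crossPairs (block m)) (crossPairs (block m′))
    distinct-crossPairs-disjoint m≁m′ (ab∈ , ab∈′) =
      m≁m′ (∈-members-block⇒ReachGF (proj₁ (∈-crossPairs⁻ (block-apart _) ab∈))
            ◅◅ ReachGF.sym (∈-members-block⇒ReachGF (proj₁ (∈-crossPairs⁻ (block-apart _) ab∈′))))

  allCrossPairs⊆F± : allCrossPairs ⊆ F ++ map swap F
  allCrossPairs⊆F± p∈ with find (∈-concatMap⁻ (crossPairs ∘ block) {xs = GFLeaders.leaders} p∈)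
  ... | m , _ , p∈crossPairs = crossPairs-block⊆F± m p∈crossPairs

  sum-spp-sizes≤length : sum (map spp sizes) ≤ length F
  sum-spp-sizes≤length = *-cancelˡ-≤ 2 (begin
    2 * sum (map spp sizes)        ≡⟨ sym (length-allCrossPairs GFLeaders.leaders) ⟩
    length allCrossPairs           ≤⟨ Unique-⊆⇒length≤ allCrossPairs-unique allCrossPairs⊆F± ⟩
    length (F ++ map swap F)       ≡⟨ length-++ F ⟩
    length F + length (map swap F) ≡⟨ cong (length F +_)
                                           (trans (length-map swap F) (sym (+-identityʳ (length F)))) ⟩
    2 * length F                   ∎)
    where open ≤-Reasoning

  Completion⇒ReachGF : Completion G blocks ⇒ Reach GF
  Completion⇒ReachGF (inj₁ uw∈G) = inj₁ uw∈G ◅ ε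
  Completion⇒ReachGF (inj₂ (_ , rs , rs∈ , a , b , a∈ , b∈ , a⇝u , b⇝w)) with ∈-blocks⁻ rs∈
  ... | m , _ , refl = ReachGF.sym (ReachG⇒ReachGF a⇝u) ◅◅ ReachGF.sym (proj₂ (∈-block⁻ a∈))
                       ◅◅ proj₂ (∈-block⁻ b∈) ◅◅ ReachG⇒ReachGF b⇝w

  GF⇒Completion : GF ⇒ Completion G blocks
  GF⇒Completion (inj₁ uw∈G) = inj₁ uw∈G
  GF⇒Completion {u} {w} (inj₂ u~w)
    with GFLeaders.leader-of (w , u~w) | GLeaders.leader-of (w , u~w)
       | GLeaders.leader-of (u , ~F-sym u~w)
  ... | m , m-leader , m⇝u | a , a-leader , a⇝u | b , b-leader , b⇝w =
    inj₂ (~F⇒≢ u~w , block m , ∈-map⁺ block (GFLeaders.∈-leaders⁺ m-leader) , a , b ,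
          ∈-block⁺ (proj₁ m-leader) a-leader (m⇝u ◅◅ ReachGF.sym (ReachG⇒ReachGF a⇝u)) ,
          ∈-block⁺ (proj₁ m-leader) b-leader
                   (m⇝u ◅◅ ~F⇒ReachGF u~w ◅◅ ReachGF.sym (ReachG⇒ReachGF b⇝w)) ,
          a⇝u , b⇝w)

  hasBalancedCompletion : ∀ {u k η} → Merged u → length F ≤ k → Balanced GF η →
                          HasBalancedCompletion G k η
  hasBalancedCompletion {k = k} u-merged |F|≤k balanced =
    sum (map sum sizes) , 2≤ℓ , ℓ≤2k ,
    map sum sizes , (Allₚ.map⁺ (All.map (≤-trans (s≤s z≤n) ∘ 2≤sum) sizes-proper) , refl) ,
    sizes , All⇒Pointwise-map (All.map (λ (pos , _) → pos , refl) sizes-proper) ,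
    (concat blocks , Pointwise.concat⁺ (proj₁ completionChoice) , blocks-apart) ,
    ≤-trans sum-spp-sizes≤length |F|≤k ,
    blocks , completionChoice ,
    Balanced-resp-Reach (Star.map GF⇒Completion) (Completion⇒ReachGF Star.⋆) balanced
    where
    2≤sum : ∀ {Y} → All (1 ≤_) Y × 2 ≤ length Y → 2 ≤ sum Y
    2≤sum (pos , 2≤len) = ≤-trans 2≤len (length≤sum pos)
    2≤ℓ : 2 ≤ sum (map sum sizes)
    2≤ℓ with GFLeaders.leader-of u-merged
    ... | m , m-leader , _ =
      let sizes-m∈ = ∈-map⁺ (map size) (∈-map⁺ block (GFLeaders.∈-leaders⁺ m-leader)) in
      ≤-trans (2≤sum (All.lookup sizes-proper sizes-m∈)) (∈⇒≤sum (∈-map⁺ sum sizes-m∈))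
    ℓ≤2k : sum (map sum sizes) ≤ 2 * k
    ℓ≤2k = ≤-trans (sum-map-sum≤2*sum-map-spp sizes-proper)
                   (*-monoʳ-≤ 2 (≤-trans sum-spp-sizes≤length |F|≤k))

mainTheorem17 : ∀ {n : ℕ} (G : Graph n) (k η : ℕ) → IsCluster G →
  (Σ (List (Fin n × Fin n)) λ F → IsNonEdgeSet G F × length F ≤ k
      × IsCluster (G +E F) × Balanced (G +E F) η) →
  Balanced G η
  ⊎ (Σ ℕ λ ℓ → 2 ≤ ℓ × ℓ ≤ 2 * k × Σ (List ℕ) λ X → IsPartition ℓ X
      × Σ (List (List ℕ)) λ Xs → Pointwise IsPartition X Xs
      × IsGValid G (concat Xs)
      × sum (map spp Xs) ≤ k
      × Σ (List (List (Fin n))) λ reps → IsCompletionChoice G Xs reps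
          × Balanced (Completion G reps) η)
mainTheorem17 G k η _ ([] , _ , _ , _ , balanced) =
  inj₁ (Balanced-resp-Reach (Star.map G+[]⇒G) (Star.map inj₁) balanced)
  where
  G+[]⇒G : G +E [] ⇒ G
  G+[]⇒G (inj₁ uv∈G) = uv∈G
  G+[]⇒G (inj₂ (inj₁ ()))
  G+[]⇒G (inj₂ (inj₂ ()))
mainTheorem17 G k η G-cluster (F@((_ , v) ∷ _) , F-nonEdges , |F|≤k , GF-cluster , balanced) =
  inj₂ (hasBalancedCompletion (v , inj₁ (here refl)) |F|≤k balanced)
  where open ClusterAugmentation G F G-cluster F-nonEdges GF-cluster
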